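{- Let $\vdash$ be a regular entailment relation for a commutative preordered group $G$ and let $a_1,\dots,a_n,b_1,\dots,b_n\in G$ ($n\geqslant1$). If $a_1+\dots+a_n=b_1+\dots+b_n$, then $a_1,\dots,a_n\vdash b_1,\dots,b_n$.
   Context: A commutative preordered group is an abelian group $G$ with a preorder $\leqslant$ such that $a\leqslant b$ implies $a+c\leqslant b+c$. $A,B,A',B'$ denote nonempty finite subsets of $G$; $a$ stands for $\{a\}$, commas denote unions (so $a_1,\dots,a_n$ is the set $\{a_1,\dots,a_n\}$), $A+y=\{a+y:a\in A\}$. A regular entailment relation for $G$ is a relation $A\vdash B$ between nonempty finite subsets such that: (R1) $A\vdash B$ if $A\supseteq A'$, $B\supseteq B'$ and $A'\vdash B'$; (R2) $A\vdash B$ if $A,y\vdash B$ and $A\vdash B,y$; (R3) $a\vdash b$ if $a\leqslant b$; (R4) $A\vdash B$ if $A+y\vdash B+y$; (R5) $a+u,b+v\vdash a+b,u+v$ for all $a,b,u,v\in G$. -}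

module Defs where

open import Level using (Level; _⊔_)
open import Data.Nat using (ℕ)
import Data.Nat as ℕ
open import Data.Fin using (Fin; zero; suc)
open import Data.Product using (∃; _×_)
open import Data.List using (List)
import Data.List as List
open import Data.List.NonEmpty using (List⁺; _∷_; _∷⁺_)
import Data.List.NonEmpty as List⁺
open import Data.List.Relation.Unary.Any using (Any)
open import Function using (_∘_)
open import Relation.Binary.Structures using (IsPreorder)
open import Algebra.Bundles using (AbelianGroup)
import Algebra.Properties.Monoid.Sum as MonoidSum

record CommPreorderedGroup (c ℓ₁ ℓ₂ : Level) : Set (Level.suc (c ⊔ ℓ₁ ⊔ ℓ₂)) where
  field
    abelianGroup : AbelianGroup c ℓ₁
  open AbelianGroup abelianGroup public
  field
    _≤_        : Carrier → Carrier → Set ℓ₂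
    isPreorder : IsPreorder _≈_ _≤_
    ≤-compat   : ∀ {a b} c → a ≤ b → (a ∙ c) ≤ (b ∙ c)

module _ {c ℓ₁ ℓ₂} (G : CommPreorderedGroup c ℓ₁ ℓ₂) where
  open CommPreorderedGroup G

  -- nonempty finite subsets of G are represented by nonempty lists;
  -- membership is taken up to the group's equality _≈_
  _∈_ : Carrier → List⁺ Carrier → Set (c ⊔ ℓ₁)
  x ∈ A = Any (x ≈_) (List⁺.toList A)

  _⊇_ : List⁺ Carrier → List⁺ Carrier → Set (c ⊔ ℓ₁)
  A ⊇ A' = ∀ {x} → x ∈ A' → x ∈ A

  _+ₛ_ : List⁺ Carrier → Carrier → List⁺ Carrier
  A +ₛ y = List⁺.map (_∙ y) A

  ⟦_⟧ : Carrier → List⁺ Carrier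
  ⟦ a ⟧ = List⁺.[ a ]

  ⟦_,_⟧ : Carrier → Carrier → List⁺ Carrier
  ⟦ a , b ⟧ = a ∷ List.[ b ]

  -- Regular entailment relation for G (axioms R1–R5); "A , y" is y ∷⁺ A.
  record IsRegularEntailment {ℓ} (_⊢_ : List⁺ Carrier → List⁺ Carrier → Set ℓ)
         : Set (c ⊔ ℓ₁ ⊔ ℓ₂ ⊔ ℓ) where
    field
      R1 : ∀ {A B A' B'} → A ⊇ A' → B ⊇ B' → A' ⊢ B' → A ⊢ B
      R2 : ∀ {A B} y → (y ∷⁺ A) ⊢ B → A ⊢ (y ∷⁺ B) → A ⊢ B
      R3 : ∀ {a b} → a ≤ b → ⟦ a ⟧ ⊢ ⟦ b ⟧
      R4 : ∀ {A B} y → (A +ₛ y) ⊢ (B +ₛ y) → A ⊢ B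
      R5 : ∀ a b u v → ⟦ a ∙ u , b ∙ v ⟧ ⊢ ⟦ a ∙ b , u ∙ v ⟧

  -- the set a₁ , … , aₙ for a family a : Fin (suc m) → G  (n = suc m ≥ 1)
  family⁺ : ∀ {m} → (Fin (ℕ.suc m) → Carrier) → List⁺ Carrier
  family⁺ a = a zero ∷ List.tabulate (a ∘ suc)

  Σ : ∀ {n} → (Fin n → Carrier) → Carrier
  Σ = MonoidSum.sum monoid

-- Cut on the element c = b₁⁻¹ + a₁ + a₂.  On one side, a₁ , a₂ ⊢ c , b₁ is an
-- instance of R5, since c + b₁ = a₁ + a₂.  On the other side, replacing a₁ , a₂
-- by c and dropping b₁ leaves two families of length n − 1 with equal sums,
-- which entail each other by induction on n.
module Submission where

open import Defs
open import Data.Nat using (ℕ; zero; suc)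
open import Data.Fin using (Fin; zero; suc)
open import Data.List.NonEmpty using (List⁺; _∷⁺_)
open import Data.List.Relation.Unary.Any as Any using (here; there)
open import Data.Vec.Functional using (_∷_; tail)
open import Relation.Binary.Structures using (IsPreorder)
import Algebra.Properties.Group as GroupProperties
import Algebra.Properties.Quasigroup as QuasigroupProperties

module _ {c ℓ₁ ℓ₂} (G : CommPreorderedGroup c ℓ₁ ℓ₂) where
  open CommPreorderedGroup G
  open GroupProperties group using (\\-leftDividesˡ; quasigroup)
  open QuasigroupProperties quasigroup using (y≈x\\z)
  open import Relation.Binary.Reasoning.Setoid setoid

  ∈-resp-≈ : ∀ {x y A} → x ≈ y → _∈_ G y A → _∈_ G x A
  ∈-resp-≈ x≈y = Any.map (trans x≈y)

  ⊇-⟦,⟧ : ∀ {x y A} → _∈_ G x A → _∈_ G y A → _⊇_ G A (⟦_,_⟧ G x y)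
  ⊇-⟦,⟧ x∈A y∈A (here z≈x)         = ∈-resp-≈ z≈x x∈A
  ⊇-⟦,⟧ x∈A y∈A (there (here z≈y)) = ∈-resp-≈ z≈y y∈A
  ⊇-⟦,⟧ x∈A y∈A (there (there ()))

  module _ {ℓ} {_⊢_ : List⁺ Carrier → List⁺ Carrier → Set ℓ}
           (regular : IsRegularEntailment G _⊢_) where
    open IsRegularEntailment regular

    ⊢-⟦,⟧-sum : ∀ {x y u v} → u ∙ v ≈ x ∙ y → ⟦_,_⟧ G x y ⊢ ⟦_,_⟧ G u v
    ⊢-⟦,⟧-sum {x} {y} {u} {v} uv≈xy =
      R1 (⊇-⟦,⟧ (here (\\-leftDividesˡ u x)) (there (here (identityˡ y))))
         (⊇-⟦,⟧ (here (identityʳ u)) (there (here u⁻¹x∙y≈v)))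
         (R5 u ε (u ⁻¹ ∙ x) y)
      where
      u⁻¹x∙y≈v : (u ⁻¹ ∙ x) ∙ y ≈ v
      u⁻¹x∙y≈v = begin
        (u ⁻¹ ∙ x) ∙ y  ≈⟨ assoc (u ⁻¹) x y ⟩
        u ⁻¹ ∙ (x ∙ y)  ≈⟨ y≈x\\z u v (x ∙ y) uv≈xy ⟨
        v               ∎

    ⊢-family⁺-sum : ∀ m (a b : Fin (suc m) → Carrier) →
                    Σ G a ≈ Σ G b → family⁺ G a ⊢ family⁺ G b
    ⊢-family⁺-sum zero a b Σa≈Σb =
      R3 (IsPreorder.reflexive isPreorder (begin
        a zero      ≈⟨ identityʳ (a zero) ⟨
        a zero ∙ ε  ≈⟨ Σa≈Σb ⟩
        b zero ∙ ε  ≈⟨ identityʳ (b zero) ⟩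
        b zero      ∎))
    ⊢-family⁺-sum (suc m) a b Σa≈Σb =
      R2 merged
        (R1 merged∷a⊇a′ there (⊢-family⁺-sum m a′ b′ Σa′≈Σb′))
        (R1 (⊇-⟦,⟧ (here refl) (there (here refl)))
            (⊇-⟦,⟧ (here refl) (there (here refl)))
            (⊢-⟦,⟧-sum merged∙b₀≈a₀∙a₁))
      where
      merged : Carrier
      merged = b zero ⁻¹ ∙ (a zero ∙ a (suc zero))

      a′ b′ : Fin (suc m) → Carrier
      a′ = merged ∷ tail (tail a)
      b′ = tail b

      merged∙b₀≈a₀∙a₁ : merged ∙ b zero ≈ a zero ∙ a (suc zero)
      merged∙b₀≈a₀∙a₁ = begin
        merged ∙ b zero  ≈⟨ comm merged (b zero) ⟩
        b zero ∙ merged  ≈⟨ \\-leftDividesˡ (b zero) _ ⟩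
        a zero ∙ a (suc zero) ∎

      Σa′≈Σb′ : Σ G a′ ≈ Σ G b′
      Σa′≈Σb′ = begin
        merged ∙ Σ G (tail (tail a))  ≈⟨ assoc (b zero ⁻¹) _ _ ⟩
        b zero ⁻¹ ∙ ((a zero ∙ a (suc zero)) ∙ Σ G (tail (tail a)))
                                      ≈⟨ ∙-congˡ (assoc (a zero) _ _) ⟩
        b zero ⁻¹ ∙ Σ G a             ≈⟨ y≈x\\z (b zero) (Σ G b′) (Σ G a) (sym Σa≈Σb) ⟨
        Σ G b′                        ∎

      merged∷a⊇a′ : _⊇_ G (merged ∷⁺ family⁺ G a) (family⁺ G a′)
      merged∷a⊇a′ (here e)  = here e
      merged∷a⊇a′ (there p) = there (there (there p))

corollary1p13 : ∀ {c ℓ₁ ℓ₂ ℓ} (G : CommPreorderedGroup c ℓ₁ ℓ₂)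
    → let open CommPreorderedGroup G in
    (_⊢_ : List⁺ Carrier → List⁺ Carrier → Set ℓ)
    → IsRegularEntailment G _⊢_
    → (m : ℕ) (a b : Fin (suc m) → Carrier)
    → Σ G a ≈ Σ G b
    → family⁺ G a ⊢ family⁺ G b
corollary1p13 G _⊢_ regular = ⊢-family⁺-sum G regular
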